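{- Let $w$ be a set of formulas of $\mathcal{L}_{\mathsf{DPL}}$ which is consistent in $\mathcal{H}_{\mathsf{DPL}}$. Then there exists a saturated set $w^*$ of formulas with $w\subseteq w^*$.
   Context: Let $\mathbb{P}$ be a countable set of propositional variables. The formulas of $\mathcal{L}_{\mathsf{DPL}}$ are given by $\varphi ::= p \mid \neg\varphi \mid \varphi\wedge\varphi \mid L_r\varphi \mid \bigcirc\varphi$ with $p\in\mathbb{P}$, $r\in\mathbb{Q}\cap[0,1]$; $\bigcirc^n$ is $n$-fold iteration of $\bigcirc$; $L_{r_1}\cdots L_{r_k}L_s\varphi$ denotes iterated application ($k\ge 0$). The Hilbert system $\mathcal{H}_{\mathsf{DPL}}$ has the axiom schemes: propositional tautologies; $L_0\bot$; $L_r\neg\varphi\to\neg L_s\varphi$ if $r+s>1$; $L_r(\varphi\wedge\psi)\wedge L_s(\varphi\wedge\neg\psi)\to L_{r+s}\varphi$ if $r+s\le 1$; $\neg L_r(\varphi\wedge\psi)\wedge\neg L_s(\varphi\wedge\neg\psi)\to\neg L_{r+s}\varphi$ if $r+s\le1$; $L_1(\varphi\to\psi)\to(L_r\varphi\to L_r\psi)$; $\bigcirc\neg\varphi\leftrightarrow\neg\bigcirc\varphi$; $\bigcirc(\varphi\wedge\psi)\leftrightarrow(\bigcirc\varphi\wedge\bigcirc\psi)$; and rules: modus ponens; the generalized Archimedean rule: for $n,k\in\mathbb{N}$, $r_1,\dots,r_k,r\in\mathbb{Q}\cap[0,1]$, from $\{\psi\to\bigcirc^nL_{r_1}\cdots L_{r_k}L_s\varphi\mid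 s<r,\ s\in\mathbb{Q}\cap[0,1]\}$ infer $\psi\to\bigcirc^nL_{r_1}\cdots L_{r_k}L_r\varphi$; from $\varphi$ infer $L_1\varphi$; from $\varphi$ infer $\bigcirc\varphi$. A theorem is the last element of a sequence $(\varphi_\beta)_{\beta\le\alpha+1}$ ($\alpha$ a countable ordinal) each element an axiom or obtained by a rule from earlier elements; $\Gamma\vdash\varphi$ means such a sequence ending in $\varphi$ each element of which is in $\Gamma$, a theorem, or obtained from earlier elements by a rule other than the two necessitation rules. $\Gamma$ is consistent if $\Gamma\nvdash\bot$, finitely consistent if each finite subset is consistent. A set $w$ of formulas is saturated if (i) $w$ is finitely consistent, (ii) for every formula $\varphi$, $\varphi\in w$ or $\neg\varphi\in w$, and (iii) for all $\varphi$, $n,k\in\mathbb{N}$, $r_1,\dots,r_k,r\in\mathbb{Q}\cap[0,1]$: if $\bigcirc^nL_{r_1}\cdots L_{r_k}L_s\varphi\in w$ for all rational $s<r$, then $\bigcirc^nL_{r_1}\cdots L_{r_k}L_r\varphi\in w$. -}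

module Defs where

open import Data.Nat using (ℕ; zero; suc)
open import Data.Bool using (Bool; true; false; not; _∧_)
open import Data.Rational using (ℚ; 0ℚ; 1ℚ; _≤_; _<_; _+_)
open import Data.List using (List; []; _∷_)
open import Data.List.Relation.Unary.All using (All)
open import Data.List.Membership.Propositional using (_∈_)
open import Data.Sum using (_⊎_)
open import Relation.Nullary using (¬_)
open import Relation.Binary.PropositionalEquality using (_≡_)

record ℚ01 : Set where
  constructor mkℚ01
  field
    val : ℚ
    lo  : 0ℚ ≤ val
    hi  : val ≤ 1ℚ
open ℚ01 public

data Form : Set where
  var  : ℕ → Form
  ¬'_  : Form → Form
  _∧'_ : Form → Form → Form
  L    : ℚ01 → Form → Form
  ○    : Form → Form

infixr 6 _∧'_
infixr 5 _⇒_ _⇔_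

_⇒_ : Form → Form → Form
φ ⇒ ψ = ¬' (φ ∧' ¬' ψ)

_⇔_ : Form → Form → Form
φ ⇔ ψ = (φ ⇒ ψ) ∧' (ψ ⇒ φ)

⊥' : Form
⊥' = var 0 ∧' ¬' var 0

○^ : ℕ → Form → Form
○^ zero φ = φ
○^ (suc n) φ = ○ (○^ n φ)

Lchain : List ℚ01 → Form → Form
Lchain [] φ = φ
Lchain (r ∷ rs) φ = L r (Lchain rs φ)

-- Truth-functional evaluation: L- and ○-formulas (and variables) are atoms
eval : (Form → Bool) → Form → Bool
eval v (var p)  = v (var p)
eval v (¬' φ)   = not (eval v φ)
eval v (φ ∧' ψ) = eval v φ ∧ eval v ψ
eval v (L r φ)  = v (L r φ)
eval v (○ φ)    = v (○ φ)

Taut : Form → Set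
Taut φ = ∀ (v : Form → Bool) → eval v φ ≡ true

-- Theorems of H_DPL (inductive closure; equivalent to countable-ordinal-length proofs)
data Thm : Form → Set where
  taut : ∀ {φ} → Taut φ → Thm φ
  ax-L0 : ∀ (z : ℚ01) → val z ≡ 0ℚ → Thm (L z ⊥')
  ax-neg : ∀ (r s : ℚ01) φ → 1ℚ < val r + val s →
    Thm (L r (¬' φ) ⇒ ¬' L s φ)
  ax-add : ∀ (r s t : ℚ01) φ ψ → val t ≡ val r + val s →
    Thm ((L r (φ ∧' ψ) ∧' L s (φ ∧' ¬' ψ)) ⇒ L t φ)
  ax-nadd : ∀ (r s t : ℚ01) φ ψ → val t ≡ val r + val s →
    Thm ((¬' L r (φ ∧' ψ) ∧' ¬' L s (φ ∧' ¬' ψ)) ⇒ ¬' L t φ)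
  ax-K : ∀ (o r : ℚ01) φ ψ → val o ≡ 1ℚ →
    Thm (L o (φ ⇒ ψ) ⇒ (L r φ ⇒ L r ψ))
  ax-○¬ : ∀ φ → Thm (○ (¬' φ) ⇔ ¬' ○ φ)
  ax-○∧ : ∀ φ ψ → Thm (○ (φ ∧' ψ) ⇔ (○ φ ∧' ○ ψ))
  mp : ∀ {φ ψ} → Thm φ → Thm (φ ⇒ ψ) → Thm ψ
  arch : ∀ ψ n (rs : List ℚ01) (r : ℚ01) φ →
    (∀ (s : ℚ01) → val s < val r → Thm (ψ ⇒ ○^ n (Lchain rs (L s φ)))) →
    Thm (ψ ⇒ ○^ n (Lchain rs (L r φ)))
  nec-L : ∀ (o : ℚ01) {φ} → val o ≡ 1ℚ → Thm φ → Thm (L o φ)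
  nec-○ : ∀ {φ} → Thm φ → Thm (○ φ)

-- Derivability from a set of premises (no necessitation on premises)
data _⊢_ (Γ : Form → Set) : Form → Set where
  hyp : ∀ {φ} → Γ φ → Γ ⊢ φ
  thm : ∀ {φ} → Thm φ → Γ ⊢ φ
  mp  : ∀ {φ ψ} → Γ ⊢ φ → Γ ⊢ (φ ⇒ ψ) → Γ ⊢ ψ
  arch : ∀ ψ n (rs : List ℚ01) (r : ℚ01) φ →
    (∀ (s : ℚ01) → val s < val r → Γ ⊢ (ψ ⇒ ○^ n (Lchain rs (L s φ)))) →
    Γ ⊢ (ψ ⇒ ○^ n (Lchain rs (L r φ)))

Consistent : (Form → Set) → Set
Consistent Γ = ¬ (Γ ⊢ ⊥')

FinitelyConsistent : (Form → Set) → Set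
FinitelyConsistent Γ =
  ∀ (Δ : List Form) → All Γ Δ → Consistent (λ φ → φ ∈ Δ)

record Saturated (w : Form → Set) : Set where
  field
    finCons  : FinitelyConsistent w
    complete : ∀ φ → w φ ⊎ w (¬' φ)
    archClosed : ∀ φ n (rs : List ℚ01) (r : ℚ01) →
      (∀ (s : ℚ01) → val s < val r → w (○^ n (Lchain rs (L s φ)))) →
      w (○^ n (Lchain rs (L r φ)))

-- Lindenbaum's construction, adapted to the infinitary Archimedean rule. Enumerate all
-- formulas φ and all instances (n, r₁ … r_k, r, φ) of the rule, and extend w stage by
-- stage: for a formula add φ or ¬φ, whichever keeps the set consistent; for an instance
-- of the rule add ¬ ○ⁿL…L_s φ for some s < r if that is consistent, and otherwise
-- ○ⁿL…L_r φ, which is then derivable by the rule from the current stage. Every stage is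
-- consistent, so the union is finitely consistent, and it is complete and closed under
-- the rule because each formula and each instance was settled at its own stage.
-- Excluded middle decides the consistency tests and inverts the enumeration.

module Submission where

open import Defs
open import Level using (0ℓ)
open import Axiom.ExcludedMiddle using (ExcludedMiddle)
open import Function using (_∘_; id)
open import Function.Definitions using (Injective)
open import Data.Product using (Σ; _×_; _,_; proj₁; proj₂)
open import Data.Sum using (_⊎_; inj₁; inj₂)
open import Data.Empty using (⊥; ⊥-elim)
open import Data.Nat using (ℕ; zero; suc; _*_; _⊔_; _≤′_; ≤′-refl; ≤′-step)
open import Data.Nat.Properties using (suc-injective; *-cancelˡ-≡; even≢odd; ≤⇒≤′; m≤m⊔n; m≤n⊔m)
open import Data.Integer using (ℤ; +_; -[1+_])
open import Data.Rational using (ℚ; mkℚ; _<_)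
open import Data.Rational.Properties using (mkℚ-cong; ≤-irrelevant)
open import Data.Bool using (true; false)
open import Data.Maybe using (Maybe; just; nothing; map; zipWith)
open import Data.Maybe.Properties using (just-injective)
open import Data.List using (List; []; _∷_)
open import Data.List.Relation.Unary.All using (All; []; _∷_)
import Data.List.Relation.Unary.All as All
open import Data.List.Relation.Unary.Any using (here; there)
open import Data.Tree.Binary using (Tree; leaf; node)
open import Relation.Nullary using (Dec; yes; no; contradiction)
open import Relation.Nullary.Decidable using (decidable-stable)
open import Relation.Unary using (Pred; _⊆_; _∪_; ｛_｝)
open import Relation.Binary.PropositionalEquality using (_≡_; refl; sym; trans; cong; cong₂)

-- Coding formulas by natural numbers

-- Opaque, so that the arguments of pair-injective are inferred from equations between codes.
opaque
  pair : ℕ → ℕ → ℕ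
  pair zero    b = suc (2 * b)
  pair (suc a) b = 2 * pair a b

  pair-injective : ∀ {a b c d} → pair a b ≡ pair c d → a ≡ c × b ≡ d
  pair-injective {zero}  {b} {zero}  {d} e = refl , *-cancelˡ-≡ b d 2 (suc-injective e)
  pair-injective {zero}  {b} {suc c} {d} e = contradiction (sym e) (even≢odd (pair c d) b)
  pair-injective {suc a} {b} {zero}  {d} e = contradiction e (even≢odd (pair a b) d)
  pair-injective {suc a} {b} {suc c} {d} e =
    let a≡c , b≡d = pair-injective (*-cancelˡ-≡ (pair a b) (pair c d) 2 e) in cong suc a≡c , b≡d

ℤ-code : ℤ → ℕ
ℤ-code (+ n)    = pair 0 n
ℤ-code -[1+ n ] = pair 1 n

ℤ-code-injective : Injective _≡_ _≡_ ℤ-code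
ℤ-code-injective {+ _}      {+ _}      e = cong +_ (proj₂ (pair-injective e))
ℤ-code-injective {+ _}      { -[1+ _ ]} e with () ← proj₁ (pair-injective e)
ℤ-code-injective { -[1+ _ ]} {+ _}      e with () ← proj₁ (pair-injective e)
ℤ-code-injective { -[1+ _ ]} { -[1+ _ ]} e = cong -[1+_] (proj₂ (pair-injective e))

ℚ-code : ℚ → ℕ
ℚ-code (mkℚ n d-1 _) = pair (ℤ-code n) d-1

ℚ-code-injective : Injective _≡_ _≡_ ℚ-code
ℚ-code-injective {mkℚ _ _ _} {mkℚ _ _ _} e =
  let n≡n′ , d≡d′ = pair-injective e in mkℚ-cong (ℤ-code-injective n≡n′) d≡d′

val-injective : Injective _≡_ _≡_ val
val-injective {mkℚ01 q _ _} {mkℚ01 .q _ _} refl = cong₂ (mkℚ01 q) (≤-irrelevant _ _) (≤-irrelevant _ _)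

Label : Set
Label = ℕ ⊎ ℚ01

label-code : Label → ℕ
label-code (inj₁ n) = pair 0 n
label-code (inj₂ r) = pair 1 (ℚ-code (val r))

label-code-injective : Injective _≡_ _≡_ label-code
label-code-injective {inj₁ _} {inj₁ _} e = cong inj₁ (proj₂ (pair-injective e))
label-code-injective {inj₁ _} {inj₂ _} e with () ← proj₁ (pair-injective e)
label-code-injective {inj₂ _} {inj₁ _} e with () ← proj₁ (pair-injective e)
label-code-injective {inj₂ _} {inj₂ _} e =
  cong inj₂ (val-injective (ℚ-code-injective (proj₂ (pair-injective e))))

Code : Set
Code = Tree ℕ Label

tree-code : Code → ℕ
tree-code (leaf x)     = pair 0 (label-code x)
tree-code (node l m r) = pair (suc m) (pair (tree-code l) (tree-code r))

tree-code-injective : Injective _≡_ _≡_ tree-code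
tree-code-injective {leaf _} {leaf _} e = cong leaf (label-code-injective (proj₂ (pair-injective e)))
tree-code-injective {leaf _} {node _ _ _} e with () ← proj₁ (pair-injective e)
tree-code-injective {node _ _ _} {leaf _} e with () ← proj₁ (pair-injective e)
tree-code-injective {node _ _ _} {node _ _ _} e =
  let m≡m′ , lr≡lr′ = pair-injective e
      l≡l′ , r≡r′ = pair-injective lr≡lr′
  in cong₂ (λ (l , m) r → node l m r)
       (cong₂ _,_ (tree-code-injective l≡l′) (suc-injective m≡m′)) (tree-code-injective r≡r′)

retraction⇒injective : ∀ {A B : Set} {f : A → B} (g : B → Maybe A) →
  (∀ x → g (f x) ≡ just x) → Injective _≡_ _≡_ f
retraction⇒injective {f = f} g g∘f {x} {y} fx≡fy =
  just-injective (trans (sym (g∘f x)) (trans (cong g fx≡fy) (g∘f y)))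

Item : Set
Item = Form ⊎ (ℕ × List ℚ01 × ℚ01 × Form)

-- Node labels tag the constructor; blank fills the unused child of unary constructors.
blank : Code
blank = leaf (inj₁ 0)

encode-form : Form → Code
encode-form (var p)  = leaf (inj₁ p)
encode-form (¬' φ)   = node blank 0 (encode-form φ)
encode-form (L r φ)  = node (encode-form φ) 1 (leaf (inj₂ r))
encode-form (φ ∧' ψ) = node (encode-form φ) 2 (encode-form ψ)
encode-form (○ φ)    = node blank 3 (encode-form φ)

decode-form : Code → Maybe Form
decode-form (leaf (inj₁ p))            = just (var p)
decode-form (node _ 0 t)               = map ¬'_ (decode-form t)
decode-form (node t 1 (leaf (inj₂ r))) = map (L r) (decode-form t)
decode-form (node t 2 u)               = zipWith _∧'_ (decode-form t) (decode-form u)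
decode-form (node _ 3 t)               = map ○ (decode-form t)
decode-form _                          = nothing

decode-encode-form : ∀ φ → decode-form (encode-form φ) ≡ just φ
decode-encode-form (var p) = refl
decode-encode-form (¬' φ)   rewrite decode-encode-form φ = refl
decode-encode-form (L r φ)  rewrite decode-encode-form φ = refl
decode-encode-form (φ ∧' ψ) rewrite decode-encode-form φ | decode-encode-form ψ = refl
decode-encode-form (○ φ)    rewrite decode-encode-form φ = refl

encode-list : List ℚ01 → Code
encode-list []       = blank
encode-list (r ∷ rs) = node (leaf (inj₂ r)) 0 (encode-list rs)

decode-list : Code → Maybe (List ℚ01)
decode-list (leaf _)                   = just []
decode-list (node (leaf (inj₂ r)) _ t) = map (r ∷_) (decode-list t)
decode-list _                          = nothing

decode-encode-list : ∀ rs → decode-list (encode-list rs) ≡ just rs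
decode-encode-list []       = refl
decode-encode-list (r ∷ rs) rewrite decode-encode-list rs = refl

encode-item : Item → Code
encode-item (inj₁ φ)               = node (encode-form φ) 0 blank
encode-item (inj₂ (n , rs , r , φ)) = node (node (encode-list rs) n (leaf (inj₂ r))) 1 (encode-form φ)

decode-item : Code → Maybe Item
decode-item (node t 0 _) = map inj₁ (decode-form t)
decode-item (node (node u n (leaf (inj₂ r))) 1 t) =
  zipWith (λ rs φ → inj₂ (n , rs , r , φ)) (decode-list u) (decode-form t)
decode-item _ = nothing

decode-encode-item : ∀ i → decode-item (encode-item i) ≡ just i
decode-encode-item (inj₁ φ) rewrite decode-encode-form φ = refl
decode-encode-item (inj₂ (n , rs , r , φ)) rewrite decode-encode-list rs | decode-encode-form φ = refl

code : Item → ℕ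
code = tree-code ∘ encode-item

code-injective : Injective _≡_ _≡_ code
code-injective = retraction⇒injective {f = encode-item} decode-item decode-encode-item ∘ tree-code-injective

⊤' : Form
⊤' = ¬' ⊥'

○ⁿL : ℕ → List ℚ01 → ℚ01 → Form → Form
○ⁿL n rs r φ = ○^ n (Lchain rs (L r φ))

taut-⊤ : Thm ⊤'
taut-⊤ = taut table
  where
  table : Taut ⊤'
  table v with v (var 0)
  ... | true  = refl
  ... | false = refl

taut-refl : ∀ {A} → Thm (A ⇒ A)
taut-refl {A} = taut table
  where
  table : Taut (A ⇒ A)
  table v with eval v A
  ... | true  = refl
  ... | false = refl

taut-const : ∀ {A B} → Thm (B ⇒ (A ⇒ B))
taut-const {A} {B} = taut table
  where
  table : Taut (B ⇒ (A ⇒ B))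
  table v with eval v A | eval v B
  ... | _     | false = refl
  ... | true  | true  = refl
  ... | false | true  = refl

taut-S : ∀ {A B C} → Thm ((A ⇒ B) ⇒ ((A ⇒ (B ⇒ C)) ⇒ (A ⇒ C)))
taut-S {A} {B} {C} = taut table
  where
  table : Taut ((A ⇒ B) ⇒ ((A ⇒ (B ⇒ C)) ⇒ (A ⇒ C)))
  table v with eval v A | eval v B | eval v C
  ... | false | _     | _     = refl
  ... | true  | false | _     = refl
  ... | true  | true  | true  = refl
  ... | true  | true  | false = refl

taut-uncurry : ∀ {A B C} → Thm ((A ⇒ (B ⇒ C)) ⇒ ((A ∧' B) ⇒ C))
taut-uncurry {A} {B} {C} = taut table
  where
  table : Taut ((A ⇒ (B ⇒ C)) ⇒ ((A ∧' B) ⇒ C))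
  table v with eval v A | eval v B | eval v C
  ... | false | _     | _     = refl
  ... | true  | false | _     = refl
  ... | true  | true  | true  = refl
  ... | true  | true  | false = refl

taut-curry : ∀ {A B C} → Thm (((A ∧' B) ⇒ C) ⇒ (A ⇒ (B ⇒ C)))
taut-curry {A} {B} {C} = taut table
  where
  table : Taut (((A ∧' B) ⇒ C) ⇒ (A ⇒ (B ⇒ C)))
  table v with eval v A | eval v B | eval v C
  ... | false | _     | _     = refl
  ... | true  | false | _     = refl
  ... | true  | true  | true  = refl
  ... | true  | true  | false = refl

taut-explosion : ∀ {A} → Thm (A ⇒ (¬' A ⇒ ⊥'))
taut-explosion {A} = taut table
  where
  table : Taut (A ⇒ (¬' A ⇒ ⊥'))
  table v with eval v A | v (var 0)
  ... | true  | true  = refl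
  ... | true  | false = refl
  ... | false | _     = refl

taut-¬¬-elim : ∀ {A} → Thm ((¬' A ⇒ ⊥') ⇒ A)
taut-¬¬-elim {A} = taut table
  where
  table : Taut ((¬' A ⇒ ⊥') ⇒ A)
  table v with eval v A | v (var 0)
  ... | true  | _     = refl
  ... | false | true  = refl
  ... | false | false = refl

_∪｛_｝ : Pred Form 0ℓ → Form → Pred Form 0ℓ
Γ ∪｛ A ｝ = Γ ∪ ｛ A ｝

module _ {Γ : Pred Form 0ℓ} where

  by-taut : ∀ {A B} → Thm (A ⇒ B) → Γ ⊢ A → Γ ⊢ B
  by-taut t ⊢A = mp ⊢A (thm t)

  explosion : ∀ {A} → Γ ⊢ A → Γ ⊢ (¬' A) → Γ ⊢ ⊥'
  explosion ⊢A ⊢¬A = mp ⊢¬A (by-taut taut-explosion ⊢A)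

  -- The side formula ψ of the Archimedean rule is what lets the deduction theorem
  -- pass through it: the hypothesis A is absorbed into ψ as A ∧' ψ.
  deduction : ∀ {A B} → (Γ ∪｛ A ｝) ⊢ B → Γ ⊢ (A ⇒ B)
  deduction (hyp (inj₁ γ))    = by-taut taut-const (hyp γ)
  deduction (hyp (inj₂ refl)) = thm taut-refl
  deduction (thm t)           = by-taut taut-const (thm t)
  deduction (mp ⊢φ ⊢φ⇒ψ)      = mp (deduction ⊢φ⇒ψ) (by-taut taut-S (deduction ⊢φ))
  deduction (arch ψ n rs r φ premises) =
    by-taut taut-curry (arch _ n rs r φ λ s s<r → by-taut taut-uncurry (deduction (premises s s<r)))

  cut : ∀ {A B} → Γ ⊢ A → (Γ ∪｛ A ｝) ⊢ B → Γ ⊢ B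
  cut ⊢A ⊢B = mp ⊢A (deduction ⊢B)

  by-contradiction : ∀ {A} → (Γ ∪｛ ¬' A ｝) ⊢ ⊥' → Γ ⊢ A
  by-contradiction ⊢⊥ = by-taut taut-¬¬-elim (deduction ⊢⊥)

  consistent-∪-derivable : ∀ {A} → Γ ⊢ A → Consistent Γ → Consistent (Γ ∪｛ A ｝)
  consistent-∪-derivable ⊢A Γ-consistent = Γ-consistent ∘ cut ⊢A

  archimedean : ∀ n rs r φ → (∀ (s : ℚ01) → val s < val r → Γ ⊢ ○ⁿL n rs s φ) → Γ ⊢ ○ⁿL n rs r φ
  archimedean n rs r φ premises =
    mp (thm taut-⊤) (arch ⊤' n rs r φ λ s s<r → by-taut taut-const (premises s s<r))

⊢-mono : ∀ {Γ Δ φ} → Γ ⊆ Δ → Γ ⊢ φ → Δ ⊢ φ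
⊢-mono Γ⊆Δ (hyp γ)  = hyp (Γ⊆Δ γ)
⊢-mono Γ⊆Δ (thm t)  = thm t
⊢-mono Γ⊆Δ (mp p q) = mp (⊢-mono Γ⊆Δ p) (⊢-mono Γ⊆Δ q)
⊢-mono Γ⊆Δ (arch ψ n rs r φ premises) = arch ψ n rs r φ λ s s<r → ⊢-mono Γ⊆Δ (premises s s<r)

-- The Lindenbaum construction

module Lindenbaum (em : ExcludedMiddle 0ℓ) (w : Pred Form 0ℓ) (w-consistent : Consistent w) where

  itemAt : ℕ → Maybe Item
  itemAt k with em {Σ Item λ i → code i ≡ k}
  ... | yes (i , _) = just i
  ... | no _        = nothing

  itemAt-code : ∀ i → itemAt (code i) ≡ just i
  itemAt-code i with em {Σ Item λ j → code j ≡ code i}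
  ... | yes (j , cj≡ci) = cong just (code-injective cj≡ci)
  ... | no ∄            = contradiction (i , refl) ∄

  ArchWitness : Pred Form 0ℓ → ℕ → List ℚ01 → ℚ01 → Form → Set
  ArchWitness G n rs r φ = Σ ℚ01 λ s → val s < val r × Consistent (G ∪｛ ¬' ○ⁿL n rs s φ ｝)

  decideFormula : ∀ G φ → Dec (Consistent (G ∪｛ φ ｝)) → Form
  decideFormula G φ (yes _) = φ
  decideFormula G φ (no _)  = ¬' φ

  decideArch : ∀ G n rs r φ → Dec (ArchWitness G n rs r φ) → Form
  decideArch G n rs r φ (yes (s , _)) = ¬' ○ⁿL n rs s φ
  decideArch G n rs r φ (no _)        = ○ⁿL n rs r φ

  treat : Pred Form 0ℓ → Maybe Item → Form
  treat G nothing                        = ⊤'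
  treat G (just (inj₁ φ))                = decideFormula G φ em
  treat G (just (inj₂ (n , rs , r , φ))) = decideArch G n rs r φ em

  treat-consistent : ∀ G m → Consistent G → Consistent (G ∪｛ treat G m ｝)
  treat-consistent G nothing                        = consistent-∪-derivable (thm taut-⊤)
  treat-consistent G (just (inj₁ φ))                = decideFormula-consistent em
    where
    decideFormula-consistent : ∀ d → Consistent G → Consistent (G ∪｛ decideFormula G φ d ｝)
    decideFormula-consistent (yes consistent) _ = consistent
    decideFormula-consistent (no inconsistent) G-consistent ⊢⊥ =
      G-consistent (cut (by-contradiction ⊢⊥) (decidable-stable em inconsistent))
  treat-consistent G (just (inj₂ (n , rs , r , φ))) = decideArch-consistent em
    where
    decideArch-consistent : ∀ d → Consistent G → Consistent (G ∪｛ decideArch G n rs r φ d ｝)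
    decideArch-consistent (yes (_ , _ , consistent)) _ = consistent
    decideArch-consistent (no ∄) = consistent-∪-derivable (archimedean n rs r φ λ s s<r →
      by-contradiction (decidable-stable em λ consistent → ∄ (s , s<r , consistent)))

  stage : ℕ → Pred Form 0ℓ
  stage zero    = w
  stage (suc k) = stage k ∪｛ treat (stage k) (itemAt k) ｝

  stage-consistent : ∀ k → Consistent (stage k)
  stage-consistent zero    = w-consistent
  stage-consistent (suc k) = treat-consistent (stage k) (itemAt k) (stage-consistent k)

  stage-mono : ∀ {k m} → k ≤′ m → stage k ⊆ stage m
  stage-mono ≤′-refl        = id
  stage-mono (≤′-step k≤′m) = inj₁ ∘ stage-mono k≤′m

  w* : Pred Form 0ℓ
  w* φ = Σ ℕ λ k → stage k φ

  treated : ∀ i → w* (treat (stage (code i)) (just i))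
  treated i = suc (code i) , inj₂ (cong (treat (stage (code i))) (itemAt-code i))

  common-stage : ∀ Δ → All w* Δ → Σ ℕ λ K → All (stage K) Δ
  common-stage []      []                  = 0 , []
  common-stage (_ ∷ Δ) ((k , φ∈stage) ∷ Δ⊆w*) =
    let K , Δ⊆stage = common-stage Δ Δ⊆w*
    in k ⊔ K , stage-mono (≤⇒≤′ (m≤m⊔n k K)) φ∈stage ∷ All.map (stage-mono (≤⇒≤′ (m≤n⊔m k K))) Δ⊆stage

  finitely-consistent : FinitelyConsistent w*
  finitely-consistent Δ Δ⊆w* ⊢⊥ =
    let K , Δ⊆stage = common-stage Δ Δ⊆w*
    in stage-consistent K (⊢-mono (All.lookup Δ⊆stage) ⊢⊥)

  no-contradiction : ∀ {A} → w* A → w* (¬' A) → ⊥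
  no-contradiction A∈w* ¬A∈w* =
    finitely-consistent (_ ∷ _ ∷ []) (A∈w* ∷ ¬A∈w* ∷ []) (explosion (hyp (here refl)) (hyp (there (here refl))))

  complete : ∀ φ → w* φ ⊎ w* (¬' φ)
  complete φ = decided em (treated (inj₁ φ))
    where
    decided : ∀ d → w* (decideFormula _ φ d) → w* φ ⊎ w* (¬' φ)
    decided (yes _) = inj₁
    decided (no _)  = inj₂

  arch-closed : ∀ φ n rs r → (∀ (s : ℚ01) → val s < val r → w* (○ⁿL n rs s φ)) → w* (○ⁿL n rs r φ)
  arch-closed φ n rs r below = decided em (treated (inj₂ (n , rs , r , φ)))
    where
    decided : ∀ d → w* (decideArch _ n rs r φ d) → w* (○ⁿL n rs r φ)
    decided (yes (s , s<r , _)) = ⊥-elim ∘ no-contradiction (below s s<r)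
    decided (no _)              = id

  saturated : Saturated w*
  saturated = record
    { finCons    = finitely-consistent
    ; complete   = complete
    ; archClosed = arch-closed
    }

lemma3p8 : ExcludedMiddle 0ℓ → (w : Form → Set) → Consistent w →
    Σ (Form → Set) (λ w* → ((φ : Form) → w φ → w* φ) × Saturated w*)
lemma3p8 em w w-consistent = w* , (λ _ φ∈w → 0 , φ∈w) , saturated
  where open Lindenbaum em w w-consistent
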